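{- In the call-by-value $\lambda\Box$-calculus, if $\Gamma\vdash M:\tau$ and $M\to_vN$, then $\Gamma\vdash N:\tau$.
   Context: Types: $\sigma::=p\mid\sigma\supset\sigma\mid\Box\sigma$. Terms: $M::=c\mid x\mid\lambda x^\sigma.M\mid MM\mid\mathbf{box}_{x_1^{\sigma_1},\dots,x_n^{\sigma_n}}(M_1,\dots,M_n;M)$. The $x_i$ are bound in the body, and the free variables of a box term are those of the $M_i$. Typing rules: - $\Gamma\vdash c^\tau:\tau$; - $\Gamma,x:\tau,\Gamma'\vdash x:\tau$; - the usual $\lambda$ and application rules; - from $x_1:\sigma_1,\dots,x_n:\sigma_n\vdash M:\tau$ and $\Gamma\vdash N_i:\Box\sigma_i$ infer $\Gamma\vdash\mathbf{box}_{\vec x}(\vec N;M):\Box\tau$. Values: $V::=c\mid x\mid\lambda x.M\mid\mathbf{box}_{\vec x}(V_1,\dots,V_n;M)$. Simple evaluation contexts: $C::=[\,]M\mid V[\,]\mid\mathbf{box}_{\vec x}(V_1,\dots,V_k,[\,],M_1,\dots,M_m;M)$. Evaluation contexts: $E::=[\,]\mid C[E]$. $\to_v$ is the closure under term contexts of the following rules ($y$ a variable, new bound variables fresh): - $(\lambda x.x)M\to M$; - $(\lambda x.M)V\to M[x:=V]$; - $\lambda x.Vx\to V$ ($x\notin FV(V)$); - $C[(\lambda x.M)N]\to(\lambda x.C[M])N$; - $C[yM]\to(\lambda x.C[x])(yM)$ if $C$ is not of the form $V[\,]$; - $(\lambda x.E[yx])M\to E[yM]$ if $x\notin FV(E[y])$;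 - $\mathbf{box}_x(M;x)\to M$; - $\mathbf{box}_{\vec w,x,\vec z}(\vec W,\mathbf{box}_{\vec y}(\vec N;V),\vec P;M)\to\mathbf{box}_{\vec w,\vec y,\vec z}(\vec W,\vec N,\vec P;M[x:=V])$, $\vec W$ values, $|\vec w|=|\vec W|$. -}

module Defs where

open import Data.Nat using (ℕ; zero; suc; _+_)
open import Data.Fin using (Fin; zero; suc; _↑ˡ_; _↑ʳ_; splitAt)
open import Data.Vec using (Vec; []; _∷_; _++_; lookup)
open import Data.Vec.Relation.Unary.All using (All)
open import Data.Sum using (inj₁; inj₂)
open import Relation.Binary.PropositionalEquality using (_≡_)
open import Relation.Nullary using (¬_)
open import Data.Unit using (⊤)
open import Data.Empty using (⊥)

infixr 7 _⊃_
data Ty : Set where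
  atom : ℕ → Ty
  _⊃_  : Ty → Ty → Ty
  □_   : Ty → Ty

-- Terms, well-scoped de Bruijn: Term n has free variables among Fin n.
--   const τ c         = constant c^τ  (constant names are ℕ)
--   lam σ M           = λx^σ.M        (M in scope suc n, x = var zero)
--   box k σs Ns M     = box_{x1^σ1..xk^σk}(N1..Nk; M), M in scope k with
--                       x_i = var i; the body is closed w.r.t. the outer scope
--                       (free variables of the box term are those of the Ns).

data Term (n : ℕ) : Set where
  const : Ty → ℕ → Term n
  var   : Fin n → Term n
  lam   : Ty → Term (suc n) → Term n
  app   : Term n → Term n → Term n
  box   : (k : ℕ) → Vec Ty k → Vec (Term n) k → Term k → Term n

Ctx : ℕ → Set
Ctx n = Vec Ty n

-- Renaming and substitution (box bodies are untouched: they are closed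
-- apart from their own bound variables).

ext : ∀ {n m} → (Fin n → Fin m) → Fin (suc n) → Fin (suc m)
ext ρ zero    = zero
ext ρ (suc i) = suc (ρ i)

mutual
  rename : ∀ {n m} → (Fin n → Fin m) → Term n → Term m
  rename ρ (const τ c)    = const τ c
  rename ρ (var i)        = var (ρ i)
  rename ρ (lam σ M)      = lam σ (rename (ext ρ) M)
  rename ρ (app M N)      = app (rename ρ M) (rename ρ N)
  rename ρ (box k σs Ns M) = box k σs (renames ρ Ns) M

  renames : ∀ {n m k} → (Fin n → Fin m) → Vec (Term n) k → Vec (Term m) k
  renames ρ []       = []
  renames ρ (N ∷ Ns) = rename ρ N ∷ renames ρ Ns

weaken : ∀ {n} → Term n → Term (suc n)
weaken = rename suc

exts : ∀ {n m} → (Fin n → Term m) → Fin (suc n) → Term (suc m)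
exts s zero    = var zero
exts s (suc i) = weaken (s i)

mutual
  subst : ∀ {n m} → (Fin n → Term m) → Term n → Term m
  subst s (const τ c)     = const τ c
  subst s (var i)         = s i
  subst s (lam σ M)       = lam σ (subst (exts s) M)
  subst s (app M N)       = app (subst s M) (subst s N)
  subst s (box k σs Ns M) = box k σs (substs s Ns) M

  substs : ∀ {n m k} → (Fin n → Term m) → Vec (Term n) k → Vec (Term m) k
  substs s []       = []
  substs s (N ∷ Ns) = subst s N ∷ substs s Ns

subst-zero : ∀ {n} → Term n → Fin (suc n) → Term n
subst-zero V zero    = V
subst-zero V (suc i) = var i

_[0≔_] : ∀ {n} → Term (suc n) → Term n → Term n
M [0≔ V ] = subst (subst-zero V) M

-- Substitution used by the box-merging rule: the body M lives in scope
-- w⃗ , x , z⃗  (a + suc b); x is replaced by V (scope y⃗ = c), giving a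
-- body in scope  w⃗ , y⃗ , z⃗  (a + (c + b)).
subst-mid : ∀ a b {c} → Term c → Fin (a + suc b) → Term (a + (c + b))
subst-mid a b {c} V i with splitAt a i
... | inj₁ j       = var (j ↑ˡ (c + b))
... | inj₂ zero    = rename (λ l → a ↑ʳ (l ↑ˡ b)) V
... | inj₂ (suc l) = var (a ↑ʳ (c ↑ʳ l))

infix 4 _⊢_∶_ _⊢*_∶□_

mutual
  data _⊢_∶_ {n : ℕ} (Γ : Ctx n) : Term n → Ty → Set where
    ⊢const : ∀ {τ c} → Γ ⊢ const τ c ∶ τ
    ⊢var   : ∀ {i} → Γ ⊢ var i ∶ lookup Γ i
    ⊢lam   : ∀ {σ τ M} → (σ ∷ Γ) ⊢ M ∶ τ → Γ ⊢ lam σ M ∶ σ ⊃ τ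
    ⊢app   : ∀ {σ τ M N} → Γ ⊢ M ∶ σ ⊃ τ → Γ ⊢ N ∶ σ → Γ ⊢ app M N ∶ τ
    ⊢box   : ∀ {k σs Ns M τ} → σs ⊢ M ∶ τ → Γ ⊢* Ns ∶□ σs
           → Γ ⊢ box k σs Ns M ∶ □ τ

  data _⊢*_∶□_ {n : ℕ} (Γ : Ctx n) : ∀ {k} → Vec (Term n) k → Vec Ty k → Set where
    []  : Γ ⊢* [] ∶□ []
    _∷_ : ∀ {k N σ} {Ns : Vec (Term n) k} {σs}
        → Γ ⊢ N ∶ □ σ → Γ ⊢* Ns ∶□ σs → Γ ⊢* (N ∷ Ns) ∶□ (σ ∷ σs)

data Value {n : ℕ} : Term n → Set where
  v-const : ∀ {τ c} → Value (const τ c)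
  v-var   : ∀ {i} → Value (var i)
  v-lam   : ∀ {σ M} → Value (lam σ M)
  v-box   : ∀ {k σs Vs M} → All Value Vs → Value (box k σs Vs M)

-- Simple evaluation contexts  C ::= [ ]M | V[ ] | box_x⃗(V1..Vk, [ ], M1..Mm; M)
-- (raw shapes; the value side conditions are the predicate SimpleCtx)

data Frame (n : ℕ) : Set where
  appL : Term n → Frame n
  appR : Term n → Frame n
  boxF : (k m : ℕ) → Vec Ty (k + suc m)
       → Vec (Term n) k → Vec (Term n) m → Term (k + suc m) → Frame n

data SimpleCtx {n : ℕ} : Frame n → Set where
  s-appL : ∀ {M} → SimpleCtx (appL M)
  s-appR : ∀ {V} → Value V → SimpleCtx (appR V)
  s-boxF : ∀ {k m σs Vs Ms M} → All Value Vs → SimpleCtx (boxF k m σs Vs Ms M)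

plugF : ∀ {n} → Frame n → Term n → Term n
plugF (appL M) P              = app P M
plugF (appR V) P              = app V P
plugF (boxF k m σs Vs Ms M) P = box (k + suc m) σs (Vs ++ (P ∷ Ms)) M

renameF : ∀ {n m} → (Fin n → Fin m) → Frame n → Frame m
renameF ρ (appL M)              = appL (rename ρ M)
renameF ρ (appR V)              = appR (rename ρ V)
renameF ρ (boxF k m σs Vs Ms M) = boxF k m σs (renames ρ Vs) (renames ρ Ms) M

IsAppR : ∀ {n} → Frame n → Set
IsAppR (appR _) = ⊤
IsAppR _        = ⊥

data ECtx (n : ℕ) : Set where
  hole : ECtx n
  _∘E_ : Frame n → ECtx n → ECtx n

data EvalCtx {n : ℕ} : ECtx n → Set where
  e-hole : EvalCtx hole
  e-cons : ∀ {C E} → SimpleCtx C → EvalCtx E → EvalCtx (C ∘E E)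

plugE : ∀ {n} → ECtx n → Term n → Term n
plugE hole     P = P
plugE (C ∘E E) P = plugF C (plugE E P)

renameE : ∀ {n m} → (Fin n → Fin m) → ECtx n → ECtx m
renameE ρ hole     = hole
renameE ρ (C ∘E E) = renameF ρ C ∘E renameE ρ E

-- Variables are typed (Church style); Γ records the types of the free
-- variables.  It is only used to annotate the fresh λ-variable in the
-- rule  C[yM] → (λx.C[x])(yM),  which receives the type of yM.

infix 4 _⊢_⟶v_ _⊢_⟶v*_

mutual
  data _⊢_⟶v_ {n : ℕ} (Γ : Ctx n) : Term n → Term n → Set where
    β-id   : ∀ {σ M} → Γ ⊢ app (lam σ (var zero)) M ⟶v M
    β-v    : ∀ {σ M V} → Value V → Γ ⊢ app (lam σ M) V ⟶v M [0≔ V ]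
    η-v    : ∀ {σ V} → Value V → Γ ⊢ lam σ (app (weaken V) (var zero)) ⟶v V
    lift-β : ∀ {C σ M N} → SimpleCtx C
           → Γ ⊢ plugF C (app (lam σ M) N) ⟶v app (lam σ (plugF (renameF suc C) M)) N
    lift-y : ∀ {C y M σ τ} → SimpleCtx C → ¬ IsAppR C → lookup Γ y ≡ σ ⊃ τ
           → Γ ⊢ plugF C (app (var y) M)
               ⟶v app (lam τ (plugF (renameF suc C) (var zero))) (app (var y) M)
    -- (λx.E[yx])M → E[yM]   if x ∉ FV(E[y])
    unlift : ∀ {E y σ M} → EvalCtx E
           → Γ ⊢ app (lam σ (plugE (renameE suc E) (app (var (suc y)) (var zero)))) M
               ⟶v plugE E (app (var y) M)
    box-id : ∀ {σ M} → Γ ⊢ box 1 (σ ∷ []) (M ∷ []) (var zero) ⟶v M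
    box-merge : ∀ {a b c} {ws : Vec Ty a} {σ} {zs : Vec Ty b} {ys : Vec Ty c}
                  {Ws : Vec (Term n) a} {Ns : Vec (Term n) c} {Ps : Vec (Term n) b}
                  {V : Term c} {M : Term (a + suc b)}
              → All Value Ws → Value V
              → Γ ⊢ box (a + suc b) (ws ++ (σ ∷ zs))
                      (Ws ++ (box c ys Ns V ∷ Ps)) M
                  ⟶v box (a + (c + b)) (ws ++ (ys ++ zs))
                      (Ws ++ (Ns ++ Ps)) (subst (subst-mid a b V) M)
    ξ-lam  : ∀ {σ M M'} → (σ ∷ Γ) ⊢ M ⟶v M' → Γ ⊢ lam σ M ⟶v lam σ M'
    ξ-appL : ∀ {M M' N} → Γ ⊢ M ⟶v M' → Γ ⊢ app M N ⟶v app M' N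
    ξ-appR : ∀ {M N N'} → Γ ⊢ N ⟶v N' → Γ ⊢ app M N ⟶v app M N'
    ξ-boxA : ∀ {k σs Ns Ns' M} → Γ ⊢ Ns ⟶v* Ns'
           → Γ ⊢ box k σs Ns M ⟶v box k σs Ns' M
    ξ-boxB : ∀ {k σs Ns M M'} → σs ⊢ M ⟶v M'
           → Γ ⊢ box k σs Ns M ⟶v box k σs Ns M'

  data _⊢_⟶v*_ {n : ℕ} (Γ : Ctx n) : ∀ {k} → Vec (Term n) k → Vec (Term n) k → Set where
    here  : ∀ {k N N'} {Ns : Vec (Term n) k} → Γ ⊢ N ⟶v N' → Γ ⊢ (N ∷ Ns) ⟶v* (N' ∷ Ns)
    there : ∀ {k N} {Ns Ns' : Vec (Term n) k} → Γ ⊢ Ns ⟶v* Ns' → Γ ⊢ (N ∷ Ns) ⟶v* (N ∷ Ns')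

module Submission where

-- The argument is the standard one, organised around three kinds of
-- structural facts about typing derivations.
--   * Renamings and substitutions: a typing-respecting renaming preserves
--     typing and, read backwards, also reflects it (strengthening); a
--     typing-respecting substitution preserves typing.
--   * Contexts: a typed term C[P] (resp. E[P]) for a simple evaluation
--     context C (resp. an evaluation context E) decomposes into a typing of
--     the context as a function ρ ⇒ τ and a typing of P at ρ; conversely any
--     such pair plugs back together.
--   * The box-merging substitution M[x:=V] is typing-respecting from the
--     scope w⃗,x,z⃗ to the scope w⃗,y⃗,z⃗ whenever y⃗ ⊢ V : σ and x : σ.
-- Each reduction axiom is then handled by a lemma stating that typing of
-- its left-hand side yields typing of its right-hand side (none of them
-- needs the value side conditions), and proposition4 follows by induction
-- on the reduction, the congruence rules being immediate.

open import Defs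
open import Data.Nat using (ℕ; suc; _+_)
open import Data.Fin using (Fin; zero; suc; _↑ˡ_; _↑ʳ_; splitAt)
open import Data.Fin.Properties using (splitAt⁻¹-↑ˡ; splitAt⁻¹-↑ʳ)
open import Data.Vec using (Vec; []; _∷_; _++_; lookup)
import Data.Vec as Vec
open import Data.Vec.Properties using (lookup-++ˡ; lookup-++ʳ)
open import Data.Sum using (inj₁; inj₂)
open import Data.Product using (Σ-syntax; _×_; _,_)
open import Relation.Binary.PropositionalEquality
  using (_≡_; refl; sym; trans; module ≡-Reasoning)
  renaming (subst to transport)

private
  variable
    n m k : ℕ
    Γ Δ : Ctx n
    σ τ ρ : Ty

var-typed : ∀ {i} → lookup Γ i ≡ τ → Γ ⊢ var i ∶ τ
var-typed {Γ = Γ} {i = i} eq = transport (Γ ⊢ var i ∶_) eq ⊢var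

var-typed⁻¹ : ∀ {i} → Γ ⊢ var i ∶ τ → lookup Γ i ≡ τ
var-typed⁻¹ ⊢var = refl

++-typed : ∀ {a b} {Ws : Vec (Term n) a} {ws} {Xs : Vec (Term n) b} {xs}
         → Γ ⊢* Ws ∶□ ws → Γ ⊢* Xs ∶□ xs → Γ ⊢* Ws ++ Xs ∶□ ws ++ xs
++-typed []       es = es
++-typed (d ∷ ds) es = d ∷ ++-typed ds es

++-typed⁻¹ : ∀ {a b} (Ws : Vec (Term n) a) (ws : Vec Ty a) {Xs : Vec (Term n) b} {xs}
           → Γ ⊢* Ws ++ Xs ∶□ ws ++ xs → (Γ ⊢* Ws ∶□ ws) × (Γ ⊢* Xs ∶□ xs)
++-typed⁻¹ []       []       ds       = [] , ds
++-typed⁻¹ (_ ∷ Ws) (_ ∷ ws) (d ∷ ds) with ++-typed⁻¹ Ws ws ds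
... | dWs , dXs = d ∷ dWs , dXs

TypedRenaming : (Fin n → Fin m) → Ctx n → Ctx m → Set
TypedRenaming r Γ Δ = ∀ i → lookup Δ (r i) ≡ lookup Γ i

ext-typed : ∀ {r : Fin n → Fin m} → TypedRenaming r Γ Δ
          → TypedRenaming (ext r) (σ ∷ Γ) (σ ∷ Δ)
ext-typed h zero    = refl
ext-typed h (suc i) = h i

suc-typed : ∀ (Γ : Ctx n) σ → TypedRenaming suc Γ (σ ∷ Γ)
suc-typed Γ σ i = refl

mutual
  rename-typed : ∀ {M} (r : Fin n → Fin m) → TypedRenaming r Γ Δ
               → Γ ⊢ M ∶ τ → Δ ⊢ rename r M ∶ τ
  rename-typed r h ⊢const      = ⊢const
  rename-typed r h (⊢var {i})  = var-typed (h i)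
  rename-typed r h (⊢lam d)    = ⊢lam (rename-typed (ext r) (ext-typed h) d)
  rename-typed r h (⊢app d e)  = ⊢app (rename-typed r h d) (rename-typed r h e)
  rename-typed r h (⊢box d ds) = ⊢box d (renames-typed r h ds)

  renames-typed : ∀ {Ns : Vec (Term n) k} {σs} (r : Fin n → Fin m) → TypedRenaming r Γ Δ
                → Γ ⊢* Ns ∶□ σs → Δ ⊢* renames r Ns ∶□ σs
  renames-typed r h []       = []
  renames-typed r h (d ∷ ds) = rename-typed r h d ∷ renames-typed r h ds

mutual
  rename-reflects : (r : Fin n → Fin m) → TypedRenaming r Γ Δ
                  → (M : Term n) → Δ ⊢ rename r M ∶ τ → Γ ⊢ M ∶ τ
  rename-reflects r h (const _ _)   ⊢const      = ⊢const
  rename-reflects r h (var i)       d           = var-typed (trans (sym (h i)) (var-typed⁻¹ d))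
  rename-reflects r h (lam _ M)     (⊢lam d)    = ⊢lam (rename-reflects (ext r) (ext-typed h) M d)
  rename-reflects r h (app M N)     (⊢app d e)  = ⊢app (rename-reflects r h M d) (rename-reflects r h N e)
  rename-reflects r h (box _ _ Ns _) (⊢box d ds) = ⊢box d (renames-reflects r h Ns ds)

  renames-reflects : ∀ {σs} (r : Fin n → Fin m) → TypedRenaming r Γ Δ
                   → (Ns : Vec (Term n) k) → Δ ⊢* renames r Ns ∶□ σs → Γ ⊢* Ns ∶□ σs
  renames-reflects r h []       []       = []
  renames-reflects r h (N ∷ Ns) (d ∷ ds) = rename-reflects r h N d ∷ renames-reflects r h Ns ds

TypedSubstitution : (Fin n → Term m) → Ctx n → Ctx m → Set
TypedSubstitution s Γ Δ = ∀ i → Δ ⊢ s i ∶ lookup Γ i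

exts-typed : ∀ {s : Fin n → Term m} → TypedSubstitution s Γ Δ
           → TypedSubstitution (exts s) (σ ∷ Γ) (σ ∷ Δ)
exts-typed h zero    = ⊢var
exts-typed {Δ = Δ} {σ = σ} h (suc i) = rename-typed suc (suc-typed Δ σ) (h i)

mutual
  subst-typed : ∀ {M} (s : Fin n → Term m) → TypedSubstitution s Γ Δ
              → Γ ⊢ M ∶ τ → Δ ⊢ subst s M ∶ τ
  subst-typed s h ⊢const      = ⊢const
  subst-typed s h (⊢var {i})  = h i
  subst-typed s h (⊢lam d)    = ⊢lam (subst-typed (exts s) (exts-typed h) d)
  subst-typed s h (⊢app d e)  = ⊢app (subst-typed s h d) (subst-typed s h e)
  subst-typed s h (⊢box d ds) = ⊢box d (substs-typed s h ds)

  substs-typed : ∀ {Ns : Vec (Term n) k} {σs} (s : Fin n → Term m) → TypedSubstitution s Γ Δ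
               → Γ ⊢* Ns ∶□ σs → Δ ⊢* substs s Ns ∶□ σs
  substs-typed s h []       = []
  substs-typed s h (d ∷ ds) = subst-typed s h d ∷ substs-typed s h ds

subst-zero-typed : ∀ {V} → Γ ⊢ V ∶ σ → TypedSubstitution (subst-zero V) (σ ∷ Γ) Γ
subst-zero-typed dV zero    = dV
subst-zero-typed dV (suc i) = ⊢var

lookup-++-inj₁ : ∀ {a b} (ws : Vec Ty a) (us : Vec Ty b) {i j}
               → splitAt a i ≡ inj₁ j → lookup (ws ++ us) i ≡ lookup ws j
lookup-++-inj₁ ws us eq rewrite sym (splitAt⁻¹-↑ˡ eq) = lookup-++ˡ ws us _

lookup-++-inj₂ : ∀ {a b} (ws : Vec Ty a) (us : Vec Ty b) {i j}
               → splitAt a i ≡ inj₂ j → lookup (ws ++ us) i ≡ lookup us j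
lookup-++-inj₂ ws us eq rewrite sym (splitAt⁻¹-↑ʳ eq) = lookup-++ʳ ws us _

subst-mid-typed : ∀ {a b c} (ws : Vec Ty a) (zs : Vec Ty b) (ys : Vec Ty c) {V}
                → ys ⊢ V ∶ σ → TypedSubstitution (subst-mid a b V) (ws ++ (σ ∷ zs)) (ws ++ (ys ++ zs))
subst-mid-typed {σ = σ} {a} {b} {c} ws zs ys dV i with splitAt a i in eq
... | inj₁ j = var-typed (begin
        lookup (ws ++ (ys ++ zs)) (j ↑ˡ (c + b)) ≡⟨ lookup-++ˡ ws (ys ++ zs) j ⟩
        lookup ws j                              ≡⟨ sym (lookup-++-inj₁ ws (σ ∷ zs) eq) ⟩
        lookup (ws ++ (σ ∷ zs)) i                ∎)
  where open ≡-Reasoning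
... | inj₂ zero = transport (_ ⊢ _ ∶_) (sym (lookup-++-inj₂ ws (σ ∷ zs) eq))
        (rename-typed (λ l → a ↑ʳ (l ↑ˡ b)) ys-inside dV)
  where
    ys-inside : TypedRenaming (λ l → a ↑ʳ (l ↑ˡ b)) ys (ws ++ (ys ++ zs))
    ys-inside l = trans (lookup-++ʳ ws (ys ++ zs) (l ↑ˡ b)) (lookup-++ˡ ys zs l)
... | inj₂ (suc l) = var-typed (begin
        lookup (ws ++ (ys ++ zs)) (a ↑ʳ (c ↑ʳ l)) ≡⟨ lookup-++ʳ ws (ys ++ zs) (c ↑ʳ l) ⟩
        lookup (ys ++ zs) (c ↑ʳ l)                ≡⟨ lookup-++ʳ ys zs l ⟩
        lookup zs l                               ≡⟨ sym (lookup-++-inj₂ ws (σ ∷ zs) eq) ⟩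
        lookup (ws ++ (σ ∷ zs)) i                 ∎)
  where open ≡-Reasoning

infix 4 _⊢F_∶_⇒_ _⊢E_∶_⇒_

-- Γ ⊢F C ∶ ρ ⇒ τ : plugging a term of type ρ into the frame C gives a term
-- of type τ.
data _⊢F_∶_⇒_ (Γ : Ctx n) : Frame n → Ty → Ty → Set where
  appL-typed : ∀ {M} → Γ ⊢ M ∶ σ → Γ ⊢F appL M ∶ (σ ⊃ τ) ⇒ τ
  appR-typed : ∀ {V} → Γ ⊢ V ∶ σ ⊃ τ → Γ ⊢F appR V ∶ σ ⇒ τ
  boxF-typed : ∀ {a b Vs Ms M} {ws : Vec Ty a} {xs : Vec Ty b}
             → (ws ++ (ρ ∷ xs)) ⊢ M ∶ τ → Γ ⊢* Vs ∶□ ws → Γ ⊢* Ms ∶□ xs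
             → Γ ⊢F boxF a b (ws ++ (ρ ∷ xs)) Vs Ms M ∶ □ ρ ⇒ □ τ

plugF-typed⁻¹ : ∀ {P} (C : Frame n) → Γ ⊢ plugF C P ∶ τ
              → Σ[ ρ ∈ Ty ] (Γ ⊢F C ∶ ρ ⇒ τ) × (Γ ⊢ P ∶ ρ)
plugF-typed⁻¹ (appL M) (⊢app dP dM) = _ , appL-typed dM , dP
plugF-typed⁻¹ (appR V) (⊢app dV dP) = _ , appR-typed dV , dP
plugF-typed⁻¹ (boxF a b σs Vs Ms M) (⊢box dM ds) with Vec.splitAt a σs
... | ws , _ , refl with ++-typed⁻¹ Vs ws ds
...   | dVs , (dP ∷ dMs) = _ , boxF-typed dM dVs dMs , dP

plugF-typed : ∀ {P C} → Γ ⊢F C ∶ ρ ⇒ τ → Γ ⊢ P ∶ ρ → Γ ⊢ plugF C P ∶ τ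
plugF-typed (appL-typed dM)         dP = ⊢app dP dM
plugF-typed (appR-typed dV)         dP = ⊢app dV dP
plugF-typed (boxF-typed dM dVs dMs) dP = ⊢box dM (++-typed dVs (dP ∷ dMs))

renameF-typed : ∀ {C} (r : Fin n → Fin m) → TypedRenaming r Γ Δ
              → Γ ⊢F C ∶ ρ ⇒ τ → Δ ⊢F renameF r C ∶ ρ ⇒ τ
renameF-typed r h (appL-typed dM)         = appL-typed (rename-typed r h dM)
renameF-typed r h (appR-typed dV)         = appR-typed (rename-typed r h dV)
renameF-typed r h (boxF-typed dM dVs dMs) =
  boxF-typed dM (renames-typed r h dVs) (renames-typed r h dMs)

renameF-reflects : (r : Fin n → Fin m) → TypedRenaming r Γ Δ
                 → (C : Frame n) → Δ ⊢F renameF r C ∶ ρ ⇒ τ → Γ ⊢F C ∶ ρ ⇒ τ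
renameF-reflects r h (appL M) (appL-typed dM) = appL-typed (rename-reflects r h M dM)
renameF-reflects r h (appR V) (appR-typed dV) = appR-typed (rename-reflects r h V dV)
renameF-reflects r h (boxF _ _ _ Vs Ms _) (boxF-typed dM dVs dMs) =
  boxF-typed dM (renames-reflects r h Vs dVs) (renames-reflects r h Ms dMs)

data _⊢E_∶_⇒_ (Γ : Ctx n) : ECtx n → Ty → Ty → Set where
  hole-typed : Γ ⊢E hole ∶ τ ⇒ τ
  ∘E-typed   : ∀ {C E α} → Γ ⊢F C ∶ ρ ⇒ τ → Γ ⊢E E ∶ α ⇒ ρ → Γ ⊢E (C ∘E E) ∶ α ⇒ τ

plugE-typed⁻¹ : ∀ {P} (E : ECtx n) → Γ ⊢ plugE E P ∶ τ
              → Σ[ ρ ∈ Ty ] (Γ ⊢E E ∶ ρ ⇒ τ) × (Γ ⊢ P ∶ ρ)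
plugE-typed⁻¹ hole     d = _ , hole-typed , d
plugE-typed⁻¹ (C ∘E E) d with plugF-typed⁻¹ C d
... | _ , dC , dEP with plugE-typed⁻¹ E dEP
...   | _ , dE , dP = _ , ∘E-typed dC dE , dP

plugE-typed : ∀ {P E} → Γ ⊢E E ∶ ρ ⇒ τ → Γ ⊢ P ∶ ρ → Γ ⊢ plugE E P ∶ τ
plugE-typed hole-typed        dP = dP
plugE-typed (∘E-typed dC dE) dP = plugF-typed dC (plugE-typed dE dP)

renameE-reflects : (r : Fin n → Fin m) → TypedRenaming r Γ Δ
                 → (E : ECtx n) → Δ ⊢E renameE r E ∶ ρ ⇒ τ → Γ ⊢E E ∶ ρ ⇒ τ
renameE-reflects r h hole     hole-typed        = hole-typed
renameE-reflects r h (C ∘E E) (∘E-typed dC dE) =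
  ∘E-typed (renameF-reflects r h C dC) (renameE-reflects r h E dE)

β-id-typed : ∀ {M} → Γ ⊢ app (lam σ (var zero)) M ∶ τ → Γ ⊢ M ∶ τ
β-id-typed {Γ = Γ} {M = M} (⊢app (⊢lam dx) dM) = transport (Γ ⊢ M ∶_) (var-typed⁻¹ dx) dM

β-typed : ∀ {M V} → Γ ⊢ app (lam σ M) V ∶ τ → Γ ⊢ M [0≔ V ] ∶ τ
β-typed (⊢app (⊢lam dM) dV) = subst-typed _ (subst-zero-typed dV) dM

η-typed : ∀ V → Γ ⊢ lam σ (app (weaken V) (var zero)) ∶ τ → Γ ⊢ V ∶ τ
η-typed {Γ = Γ} {σ = σ} V (⊢lam (⊢app dV dx)) with var-typed⁻¹ dx
... | refl = rename-reflects suc (suc-typed Γ σ) V dV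

lift-β-typed : ∀ {M N} (C : Frame n) → Γ ⊢ plugF C (app (lam σ M) N) ∶ τ
             → Γ ⊢ app (lam σ (plugF (renameF suc C) M)) N ∶ τ
lift-β-typed {Γ = Γ} {σ = σ} C d with plugF-typed⁻¹ C d
... | _ , dC , ⊢app (⊢lam dM) dN =
  ⊢app (⊢lam (plugF-typed (renameF-typed suc (suc-typed Γ σ) dC) dM)) dN

lift-y-typed : ∀ {y M} (C : Frame n) → lookup Γ y ≡ σ ⊃ ρ
             → Γ ⊢ plugF C (app (var y) M) ∶ τ
             → Γ ⊢ app (lam ρ (plugF (renameF suc C) (var zero))) (app (var y) M) ∶ τ
lift-y-typed {Γ = Γ} {ρ = ρ} C ty d with plugF-typed⁻¹ C d
... | _ , dC , ⊢app dy dM with trans (sym (var-typed⁻¹ dy)) ty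
...   | refl = ⊢app (⊢lam (plugF-typed (renameF-typed suc (suc-typed Γ ρ) dC) ⊢var)) (⊢app dy dM)

unlift-typed : ∀ {y M} (E : ECtx n)
             → Γ ⊢ app (lam σ (plugE (renameE suc E) (app (var (suc y)) (var zero)))) M ∶ τ
             → Γ ⊢ plugE E (app (var y) M) ∶ τ
unlift-typed {Γ = Γ} {σ = σ} E (⊢app (⊢lam dEyx) dM) with plugE-typed⁻¹ (renameE suc E) dEyx
... | _ , dE , ⊢app dy dx with var-typed⁻¹ dx
...   | refl = plugE-typed (renameE-reflects suc (suc-typed Γ σ) E dE)
                 (⊢app (var-typed (var-typed⁻¹ dy)) dM)

box-id-typed : ∀ {M} → Γ ⊢ box 1 (σ ∷ []) (M ∷ []) (var zero) ∶ τ → Γ ⊢ M ∶ τ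
box-id-typed (⊢box dx (dM ∷ [])) with var-typed⁻¹ dx
... | refl = dM

box-merge-typed : ∀ {a b c} (ws : Vec Ty a) (zs : Vec Ty b) (ys : Vec Ty c)
                    (Ws : Vec (Term n) a) {Ns Ps V M}
                → Γ ⊢ box (a + suc b) (ws ++ (σ ∷ zs)) (Ws ++ (box c ys Ns V ∷ Ps)) M ∶ τ
                → Γ ⊢ box (a + (c + b)) (ws ++ (ys ++ zs)) (Ws ++ (Ns ++ Ps))
                        (subst (subst-mid a b V) M) ∶ τ
box-merge-typed ws zs ys Ws (⊢box dM ds) with ++-typed⁻¹ Ws ws ds
... | dWs , (⊢box dV dNs ∷ dPs) =
  ⊢box (subst-typed _ (subst-mid-typed ws zs ys dV) dM) (++-typed dWs (++-typed dNs dPs))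

mutual
  proposition4 : ∀ {n : ℕ} {Γ : Ctx n} {M N : Term n} {τ : Ty}
    → Γ ⊢ M ∶ τ → Γ ⊢ M ⟶v N → Γ ⊢ N ∶ τ
  proposition4 d β-id                              = β-id-typed d
  proposition4 d (β-v _)                           = β-typed d
  proposition4 d (η-v {V = V} _)                   = η-typed V d
  proposition4 d (lift-β {C = C} _)                = lift-β-typed C d
  proposition4 d (lift-y {C = C} _ _ ty)           = lift-y-typed C ty d
  proposition4 d (unlift {E = E} _)                = unlift-typed E d
  proposition4 d box-id                            = box-id-typed d
  proposition4 d (box-merge {ws = ws} {zs = zs} {ys = ys} {Ws = Ws} _ _) =
    box-merge-typed ws zs ys Ws d
  proposition4 (⊢lam d)    (ξ-lam s)   = ⊢lam (proposition4 d s)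
  proposition4 (⊢app d e)  (ξ-appL s)  = ⊢app (proposition4 d s) e
  proposition4 (⊢app d e)  (ξ-appR s)  = ⊢app d (proposition4 e s)
  proposition4 (⊢box d ds) (ξ-boxA ss) = ⊢box d (arguments-preserved ds ss)
  proposition4 (⊢box d ds) (ξ-boxB s)  = ⊢box (proposition4 d s) ds

  arguments-preserved : ∀ {Ns Ns' : Vec (Term n) k} {σs}
                      → Γ ⊢* Ns ∶□ σs → Γ ⊢ Ns ⟶v* Ns' → Γ ⊢* Ns' ∶□ σs
  arguments-preserved (d ∷ ds) (here s)   = proposition4 d s ∷ ds
  arguments-preserved (d ∷ ds) (there ss) = d ∷ arguments-preserved ds ss
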